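{- Let $2\leq \ell\leq k\leq n$. Then $s(B_{n,k})\leq s(B_{n,\ell})$, with equality if and only if $k=\ell$, and $\mathrm{rad}(B_{n,k})\leq \mathrm{rad}(B_{n,\ell})$, where $B_{n,m}$ denotes any $m$-balanced tree of order $n$.
   Context: All graphs are finite, simple, undirected and connected; $\mathrm{dist}(u,v)$ is the number of edges of a shortest $u$–$v$ path. The status of a vertex is $s(x)=\sum_y \mathrm{dist}(x,y)$ and the status of a graph is $s(G)=\min_x s(x)$. The eccentricity is $\mathrm{ecc}(x)=\max_y\mathrm{dist}(x,y)$ and the radius is $\mathrm{rad}(G)=\min_x\mathrm{ecc}(x)$. A tree $T$ of maximum degree $m$ is called $m$-balanced if there exists a vertex $x$ such that every vertex $z$ with $\mathrm{dist}(z,x)\leq \mathrm{ecc}(x)-2$ satisfies $\deg(z)=m$. The status and radius of an $m$-balanced tree of order $n$ depend only on $n$ and $m$; $B_{n,m}$ denotes an arbitrary $m$-balanced tree of order $n$. -}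

module Defs where

open import Data.Nat using (ℕ; zero; suc; _+_; _≤_; _⊔_; _⊓_)
open import Data.Bool using (Bool; true; false; _∨_; _∧_; if_then_else_)
open import Data.Fin using (Fin) renaming (zero to fz; suc to fs)
open import Data.Fin.Properties using (_≟_)
open import Data.List using (List; []; _∷_; length; map; allFin; _∷ʳ_)
open import Data.Bool.ListAction using (any)
open import Data.Nat.ListAction using (sum)
open import Data.List.Relation.Unary.Unique.Propositional using (Unique)
open import Data.List.Relation.Unary.Linked using (Linked)
open import Data.Product using (Σ; ∃; _×_)
open import Relation.Binary.PropositionalEquality using (_≡_)
open import Relation.Nullary.Decidable using (⌊_⌋)
open import Relation.Nullary using (¬_)

record Graph (n : ℕ) : Set where
  field
    adj   : Fin n → Fin n → Bool
    sym   : ∀ u v → adj u v ≡ adj v u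
    irrefl : ∀ u → adj u u ≡ false
open Graph public

module _ {n : ℕ} (G : Graph n) where

  Adj : Fin n → Fin n → Set
  Adj u v = adj G u v ≡ true

  reach : ℕ → Fin n → Fin n → Bool
  reach zero    u v = ⌊ u ≟ v ⌋
  reach (suc k) u v = reach k u v ∨ any (λ w → reach k u w ∧ adj G w v) (allFin n)

  Connected : Set
  Connected = ∀ u v → ∃ λ k → reach k u v ≡ true

  Cycle : Set
  Cycle = Σ (Fin n) λ x → Σ (List (Fin n)) λ xs →
            (2 ≤ length xs) × Unique (x ∷ xs) × Linked Adj ((x ∷ xs) ∷ʳ x)

  IsTree : Set
  IsTree = Connected × ¬ Cycle

-- bounded search: least j with i ≤ j < i + fuel and p j = true (or i + fuel if none)
search : ℕ → ℕ → (ℕ → Bool) → ℕ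
search i zero       p = i
search i (suc fuel) p = if p i then i else search (suc i) fuel p

maxF : ∀ {n} → (Fin n → ℕ) → ℕ
maxF {zero}  f = 0
maxF {suc n} f = f fz ⊔ maxF (λ i → f (fs i))

minF : ∀ {n} → (Fin n → ℕ) → ℕ
minF {zero}        f = 0
minF {suc zero}    f = f fz
minF {suc (suc n)} f = f fz ⊓ minF (λ i → f (fs i))

sumF : ∀ {n} → (Fin n → ℕ) → ℕ
sumF {n} f = sum (map f (allFin n))

module _ {n : ℕ} (G : Graph n) where

  -- dist u v = length of a shortest u–v walk (least k with reach k u v);
  -- in a connected graph on n vertices this is always < n, so the search finds it.
  dist : Fin n → Fin n → ℕ
  dist u v = search 0 n (λ k → reach G k u v)

  deg : Fin n → ℕ
  deg x = sumF (λ y → if adj G x y then 1 else 0)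

  MaxDegree : ℕ → Set
  MaxDegree m = (∀ x → deg x ≤ m) × ∃ λ x → deg x ≡ m

  statusV : Fin n → ℕ
  statusV x = sumF (λ y → dist x y)

  status : ℕ
  status = minF statusV

  ecc : Fin n → ℕ
  ecc x = maxF (λ y → dist x y)

  rad : ℕ
  rad = minF ecc

  IsBalancedTree : ℕ → Set
  IsBalancedTree m = IsTree G × MaxDegree m ×
    ∃ λ x → ∀ z → dist z x + 2 ≤ ecc x → deg z ≡ m

module Submission where

-- Balanced trees maximise the growth of balls, hence minimise status and radius.
--
-- Let T be k-balanced with witness vertex x, e = ecc(x), and T′ any graph of maximum
-- degree ℓ ≤ k with any vertex y.  Write a_j, b_j for the sizes of the spheres of radius
-- j around x in T and around y in T′.  Breadth-first layers of a tree form a rooted tree,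
-- so a_0 = 1, a_1 ≥ k and a_{j+1} ≥ (k-1) a_j while j+1 < e, whereas in any graph of
-- maximum degree ℓ we have b_0 ≤ 1, b_1 ≤ ℓ and b_{j+1} ≤ (ℓ-1) b_j.  Hence b_j ≤ a_j for
-- j < e, and the balls satisfy |B′_i(y)| ≤ |B_i(x)| for every radius i (for i ≥ e the
-- ball around x is everything).  Since s(v) = Σ_{i<n} (n - |B_i(v)|), this gives
-- s(x) ≤ s(y); when ℓ < k already |B′_1(y)| ≤ 1 + ℓ < 1 + k ≤ |B_1(x)|, so s(x) < s(y).
-- Likewise B′_{ecc(y)}(y) is everything, so B_{ecc(y)}(x) is too and ecc(x) ≤ ecc(y).
-- Minimising over vertices yields the statements about s and rad.

open import Defs renaming (sym to adj-sym; irrefl to adj-irrefl)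
open import Data.Bool using (Bool; true; false; _∨_; _∧_; not; if_then_else_)
open import Data.Bool.Properties using (T-≡; ∧-zeroʳ; not-injective)
open import Data.Fin using (Fin; toℕ; fromℕ<) renaming (zero to fz; suc to fs)
open import Data.Fin.Properties using (toℕ<n; toℕ-fromℕ<) renaming (_≟_ to _≟ᶠ_; suc-injective to fs-injective)
open import Data.List using (List; []; _∷_; map; allFin; tabulate; _∷ʳ_; length)
open import Data.List.Properties using (map-tabulate)
import Data.List.Relation.Unary.Any as Any
open import Data.List.Relation.Unary.Any.Properties using (any⁺; any⁻)
open import Data.List.Membership.Propositional.Properties using (∈-allFin)
open import Data.Bool.ListAction using (any)
import Data.Nat.ListAction as List
open import Data.Nat
open import Data.Nat.Properties
open import Algebra.Properties.CommutativeMonoid.Sum +-0-commutativeMonoid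
  using (sum-cong-≗; ∑-distrib-+; ∑-comm; sum-replicate-zero) renaming (sum to ∑)
open import Data.Product using (∃; _×_; _,_; proj₁; proj₂)
open import Data.Sum using (_⊎_; inj₁; inj₂)
open import Data.List.Relation.Unary.All as All using (All; []; _∷_)
open import Data.List.Relation.Unary.All.Properties using (∷ʳ⁺)
open import Data.List.Relation.Unary.AllPairs using ([]; _∷_)
open import Data.List.Relation.Unary.Linked using (Linked; []; [-]; _∷_)
open import Data.List.Relation.Unary.Unique.Propositional using (Unique)
open import Data.Empty using (⊥; ⊥-elim)
open import Function using (_∘_; Equivalence)
open import Function.Bundles using (_⇔_; mk⇔)
open import Relation.Binary.PropositionalEquality
open import Relation.Nullary using (¬_; yes; no)

true≢false : true ≢ false
true≢false ()

bool-cases : ∀ b → b ≡ true ⊎ b ≡ false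
bool-cases true  = inj₁ refl
bool-cases false = inj₂ refl

∧-true : ∀ {a b} → a ∧ b ≡ true → a ≡ true × b ≡ true
∧-true {true} {true} _ = refl , refl

∨-true : ∀ {a b} → a ∨ b ≡ true → a ≡ true ⊎ b ≡ true
∨-true {true}  _  = inj₁ refl
∨-true {false} eq = inj₂ eq

any-allFin⁺ : ∀ {n} (p : Fin n → Bool) i → p i ≡ true → any p (allFin n) ≡ true
any-allFin⁺ p i pi = Equivalence.to T-≡ (any⁺ p (Any.map (λ { refl → Equivalence.from T-≡ pi }) (∈-allFin i)))

any-allFin⁻ : ∀ {n} (p : Fin n → Bool) → any p (allFin n) ≡ true → ∃ λ i → p i ≡ true
any-allFin⁻ {n} p holds with Any.satisfied (any⁻ p (allFin n) (Equivalence.from T-≡ holds))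
... | i , pi = i , Equivalence.to T-≡ pi

sumF≡∑ : ∀ {n} (f : Fin n → ℕ) → sumF f ≡ ∑ f
sumF≡∑ {n} f = trans (cong List.sum (map-tabulate (λ i → i) f)) (sum-tabulate f)
  where
  sum-tabulate : ∀ {m} (g : Fin m → ℕ) → List.sum (tabulate g) ≡ ∑ g
  sum-tabulate {zero}  g = refl
  sum-tabulate {suc m} g = cong (g fz +_) (sum-tabulate (g ∘ fs))

∑-mono-≤ : ∀ {n} {f g : Fin n → ℕ} → (∀ i → f i ≤ g i) → ∑ f ≤ ∑ g
∑-mono-≤ {zero}  f≤g = z≤n
∑-mono-≤ {suc n} f≤g = +-mono-≤ (f≤g fz) (∑-mono-≤ (f≤g ∘ fs))

∑-mono-< : ∀ {n} {f g : Fin n → ℕ} → (∀ i → f i ≤ g i) → ∀ j → f j < g j → ∑ f < ∑ g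
∑-mono-< {suc n} f≤g fz     f<g = +-mono-<-≤ f<g (∑-mono-≤ (f≤g ∘ fs))
∑-mono-< {suc n} f≤g (fs j) f<g = +-mono-≤-< (f≤g fz) (∑-mono-< (f≤g ∘ fs) j f<g)

∑-one : ∀ n → ∑ {n} (λ _ → 1) ≡ n
∑-one zero    = refl
∑-one (suc n) = cong suc (∑-one n)

ind : Bool → ℕ
ind b = if b then 1 else 0

ind≤1 : ∀ b → ind b ≤ 1
ind≤1 true  = ≤-refl
ind≤1 false = z≤n

count : ∀ {n} → (Fin n → Bool) → ℕ
count P = ∑ (ind ∘ P)

count-cong : ∀ {n} {P Q : Fin n → Bool} → (∀ v → P v ≡ Q v) → count P ≡ count Q
count-cong P≗Q = sum-cong-≗ (cong ind ∘ P≗Q)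

count-mono : ∀ {n} {P Q : Fin n → Bool} → (∀ v → P v ≡ true → Q v ≡ true) → count P ≤ count Q
count-mono {P = P} {Q} P⇒Q = ∑-mono-≤ ind-mono
  where
  ind-mono : ∀ v → ind (P v) ≤ ind (Q v)
  ind-mono v with P v in Pv
  ... | false = z≤n
  ... | true  rewrite P⇒Q v Pv = ≤-refl

count≤n : ∀ {n} (P : Fin n → Bool) → count P ≤ n
count≤n {n} P = ≤-trans (∑-mono-≤ (ind≤1 ∘ P)) (≤-reflexive (∑-one n))

count-none : ∀ {n} {P : Fin n → Bool} → (∀ v → P v ≡ false) → count P ≡ 0
count-none {n} P≗false = trans (count-cong P≗false) (sum-replicate-zero n)

count-all : ∀ {n} {P : Fin n → Bool} → (∀ v → P v ≡ true) → count P ≡ n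
count-all {n} P≗true = trans (count-cong P≗true) (∑-one n)

count-pos : ∀ {n} (P : Fin n → Bool) v → P v ≡ true → 1 ≤ count P
count-pos P fz     Pv rewrite Pv = s≤s z≤n
count-pos P (fs v) Pv = ≤-trans (count-pos (P ∘ fs) v Pv) (m≤n+m _ _)

count-atMostOne : ∀ {n} (P : Fin n → Bool) →
                  (∀ i j → P i ≡ true → P j ≡ true → i ≡ j) → count P ≤ 1
count-atMostOne {zero}  P unique = z≤n
count-atMostOne {suc n} P unique with P fz in P0
... | true  = ≤-reflexive (cong suc (count-none others))
  where
  others : ∀ i → P (fs i) ≡ false
  others i with P (fs i) in Pi
  ... | false = refl
  ... | true  with unique fz (fs i) P0 Pi
  ... | ()
... | false = count-atMostOne (P ∘ fs) (λ i j Pi Pj → fs-injective (unique (fs i) (fs j) Pi Pj))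

count-split : ∀ {n} (P Q : Fin n → Bool) →
              count P ≡ count (λ v → P v ∧ Q v) + count (λ v → P v ∧ not (Q v))
count-split P Q = trans (sum-cong-≗ split) (∑-distrib-+ (λ v → ind (P v ∧ Q v)) (λ v → ind (P v ∧ not (Q v))))
  where
  split : ∀ v → ind (P v) ≡ ind (P v ∧ Q v) + ind (P v ∧ not (Q v))
  split v with P v | Q v
  ... | true  | true  = refl
  ... | true  | false = refl
  ... | false | _     = refl

count-compl : ∀ {n} (P : Fin n → Bool) → count P + count (not ∘ P) ≡ n
count-compl {n} P = trans (sym (count-split (λ _ → true) P)) (∑-one n)

count-full : ∀ {n} (P : Fin n → Bool) → n ≤ count P → ∀ v → P v ≡ true
count-full {n} P n≤count v with P v in Pv
... | true  = refl
... | false = ⊥-elim (<-irrefl refl (begin-strict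
    n                              ≤⟨ n≤count ⟩
    count P                        <⟨ m<m+n (count P) (count-pos (not ∘ P) v (cong not Pv)) ⟩
    count P + count (not ∘ P)      ≡⟨ count-compl P ⟩
    n                              ∎))
  where open ≤-Reasoning

count-compl-≤ : ∀ {n} (P Q : Fin n → Bool) → count P ≤ count Q → count (not ∘ Q) ≤ count (not ∘ P)
count-compl-≤ P Q P≤Q = +-cancelˡ-≤ (count P) _ _ (begin
  count P + count (not ∘ Q) ≤⟨ +-monoˡ-≤ (count (not ∘ Q)) P≤Q ⟩
  count Q + count (not ∘ Q) ≡⟨ trans (count-compl Q) (sym (count-compl P)) ⟩
  count P + count (not ∘ P) ∎)
  where open ≤-Reasoning

count-compl-< : ∀ {n} (P Q : Fin n → Bool) → count P < count Q → count (not ∘ Q) < count (not ∘ P)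
count-compl-< P Q P<Q = +-cancelˡ-< (count P) _ _ (begin-strict
  count P + count (not ∘ Q) <⟨ +-monoˡ-< (count (not ∘ Q)) P<Q ⟩
  count Q + count (not ∘ Q) ≡⟨ trans (count-compl Q) (sym (count-compl P)) ⟩
  count P + count (not ∘ P) ∎)
  where open ≤-Reasoning

sumOver : ∀ {n} → (Fin n → Bool) → (Fin n → ℕ) → ℕ
sumOver P g = ∑ (λ u → if P u then g u else 0)

sumOver-≤ : ∀ {n} (P : Fin n → Bool) (g : Fin n → ℕ) M →
            (∀ u → P u ≡ true → g u ≤ M) → sumOver P g ≤ count P * M
sumOver-≤ {zero}  P g M g≤M = z≤n
sumOver-≤ {suc n} P g M g≤M with P fz in P0
... | true  = +-mono-≤ (g≤M fz P0) (sumOver-≤ (P ∘ fs) (g ∘ fs) M (g≤M ∘ fs))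
... | false = sumOver-≤ (P ∘ fs) (g ∘ fs) M (g≤M ∘ fs)

sumOver-≥ : ∀ {n} (P : Fin n → Bool) (g : Fin n → ℕ) M →
            (∀ u → P u ≡ true → M ≤ g u) → count P * M ≤ sumOver P g
sumOver-≥ {zero}  P g M M≤g = z≤n
sumOver-≥ {suc n} P g M M≤g with P fz in P0
... | true  = +-mono-≤ (M≤g fz P0) (sumOver-≥ (P ∘ fs) (g ∘ fs) M (M≤g ∘ fs))
... | false = sumOver-≥ (P ∘ fs) (g ∘ fs) M (M≤g ∘ fs)

sumOver-count : ∀ {n} (P : Fin n → Bool) (F : Fin n → Fin n → Bool) →
                sumOver P (λ u → count (F u)) ≡ ∑ (λ v → count (λ u → P u ∧ F u v))
sumOver-count {n} P F = trans (sum-cong-≗ restrict) (∑-comm (λ u v → ind (P u ∧ F u v)))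
  where
  restrict : ∀ u → (if P u then count (F u) else 0) ≡ ∑ (λ v → ind (P u ∧ F u v))
  restrict u with P u
  ... | true  = refl
  ... | false = sym (sum-replicate-zero n)

count-≤-covering : ∀ {n} (P Q : Fin n → Bool) (R : Fin n → Fin n → Bool) →
                   (∀ v → Q v ≡ true → ∃ λ u → P u ≡ true × R u v ≡ true) →
                   count Q ≤ sumOver P (λ u → count (λ v → R u v ∧ Q v))
count-≤-covering P Q R covered =
  ≤-trans (∑-mono-≤ witness) (≤-reflexive (sym (sumOver-count P (λ u v → R u v ∧ Q v))))
  where
  witness : ∀ v → ind (Q v) ≤ count (λ u → P u ∧ (R u v ∧ Q v))
  witness v with Q v in Qv
  ... | false = z≤n
  ... | true  with covered v Qv
  ... | u , Pu , Ruv = count-pos _ u (cong₂ _∧_ Pu (cong₂ _∧_ Ruv refl))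

count-≥-disjoint : ∀ {n} (P Q : Fin n → Bool) (R : Fin n → Fin n → Bool) →
                   (∀ u u′ v → P u ≡ true → P u′ ≡ true → R u v ≡ true → R u′ v ≡ true → u ≡ u′) →
                   (∀ u v → P u ≡ true → R u v ≡ true → Q v ≡ true) →
                   sumOver P (λ u → count (R u)) ≤ count Q
count-≥-disjoint P Q R unique R⊆Q = ≤-trans (≤-reflexive (sumOver-count P R)) (∑-mono-≤ atMostOne)
  where
  atMostOne : ∀ v → count (λ u → P u ∧ R u v) ≤ ind (Q v)
  atMostOne v with Q v in Qv
  ... | true  = count-atMostOne _ λ u u′ h h′ →
                  unique u u′ v (proj₁ (∧-true h)) (proj₁ (∧-true h′)) (proj₂ (∧-true h)) (proj₂ (∧-true h′))
  ... | false = ≤-reflexive (count-none none)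
    where
    none : ∀ u → P u ∧ R u v ≡ false
    none u with P u in Pu | R u v in Ruv
    ... | true  | true  with trans (sym (R⊆Q u v Pu Ruv)) Qv
    ... | ()
    none u | true  | false = refl
    none u | false | _     = refl

search-least : ∀ s f p j → s ≤ j → p j ≡ true → search s f p ≤ j
search-least s zero    p j s≤j pj = s≤j
search-least s (suc f) p j s≤j pj with p s in ps
... | true  = s≤j
... | false with m≤n⇒m<n∨m≡n s≤j
... | inj₁ s<j  = search-least (suc s) f p j s<j pj
... | inj₂ refl with trans (sym pj) ps
... | ()

search-bound : ∀ s f p → search s f p ≤ s + f
search-bound s zero    p = m≤m+n s 0
search-bound s (suc f) p with p s
... | true  = m≤m+n s (suc f)
... | false = ≤-trans (search-bound (suc s) f p) (≤-reflexive (sym (+-suc s f)))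

search-found : ∀ s f p → search s f p < s + f → p (search s f p) ≡ true
search-found s zero    p lt = ⊥-elim (<-irrefl refl (≤-trans lt (≤-reflexive (+-identityʳ s))))
search-found s (suc f) p lt with p s in ps
... | true  = ps
... | false = search-found (suc s) f p (≤-trans lt (≤-reflexive (+-suc s f)))

UpClosed : (ℕ → Bool) → Set
UpClosed p = ∀ i → p i ≡ true → p (suc i) ≡ true

upClosed-≤ : ∀ {p} → UpClosed p → ∀ {i j} → i ≤ j → p i ≡ true → p j ≡ true
upClosed-≤ {p} up {i} i≤j pi with m≤n⇒∃[o]m+o≡n i≤j
... | t , refl = shift t
  where
  shift : ∀ t → p (i + t) ≡ true
  shift zero    rewrite +-identityʳ i = pi
  shift (suc t) rewrite +-suc i t     = up (i + t) (shift t)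

search-count : ∀ s f p → UpClosed p → search s f p ≡ s + ∑ {f} (λ t → ind (not (p (s + toℕ t))))
search-count s zero    p up = sym (+-identityʳ s)
search-count s (suc f) p up with p s in ps
... | true  = sym (trans (cong (s +_) (trans (sum-cong-≗ noFailure) (sum-replicate-zero (suc f)))) (+-identityʳ s))
  where
  noFailure : ∀ (t : Fin (suc f)) → ind (not (p (s + toℕ t))) ≡ 0
  noFailure t rewrite upClosed-≤ up (m≤m+n s (toℕ t)) ps = refl
... | false = begin
  search (suc s) f p                                       ≡⟨ search-count (suc s) f p up ⟩
  suc s + ∑ {f} (λ t → ind (not (p (suc s + toℕ t))))      ≡⟨ sym (+-suc s _) ⟩
  s + (1 + ∑ {f} (λ t → ind (not (p (suc s + toℕ t)))))    ≡⟨ cong (s +_) (cong₂ _+_ failAt0 (sum-cong-≗ {f} shift)) ⟩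
  s + ∑ {suc f} (λ t → ind (not (p (s + toℕ t))))          ∎
  where
  open ≡-Reasoning
  failAt0 : 1 ≡ ind (not (p (s + 0)))
  failAt0 rewrite +-identityʳ s | ps = refl
  shift : ∀ (t : Fin f) → ind (not (p (suc s + toℕ t))) ≡ ind (not (p (s + suc (toℕ t))))
  shift t rewrite +-suc s (toℕ t) = refl

maxF-ub : ∀ {n} (f : Fin n → ℕ) i → f i ≤ maxF f
maxF-ub f fz     = m≤m⊔n _ _
maxF-ub f (fs i) = ≤-trans (maxF-ub (f ∘ fs) i) (m≤n⊔m _ _)

maxF-lub : ∀ {n} (f : Fin n → ℕ) b → (∀ i → f i ≤ b) → maxF f ≤ b
maxF-lub {zero}  f b f≤b = z≤n
maxF-lub {suc n} f b f≤b = ⊔-lub (f≤b fz) (maxF-lub (f ∘ fs) b (f≤b ∘ fs))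

minF-lb : ∀ {n} (f : Fin n → ℕ) i → minF f ≤ f i
minF-lb {suc zero}    f fz     = ≤-refl
minF-lb {suc (suc n)} f fz     = m⊓n≤m _ _
minF-lb {suc (suc n)} f (fs i) = ≤-trans (m⊓n≤n _ _) (minF-lb (f ∘ fs) i)

minF-attained : ∀ {n} (f : Fin (suc n) → ℕ) → ∃ λ i → minF f ≡ f i
minF-attained {zero}  f = fz , refl
minF-attained {suc n} f with ⊓-sel (f fz) (minF (f ∘ fs))
... | inj₁ eq = fz , eq
... | inj₂ eq with minF-attained (f ∘ fs)
... | i , eq′ = fs i , trans eq eq′

minF-≤ : ∀ {n} (f g : Fin (suc n) → ℕ) → (∀ j → ∃ λ i → f i ≤ g j) → minF f ≤ minF g
minF-≤ f g below with minF-attained g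
... | j , eq with below j
... | i , fi≤gj = ≤-trans (minF-lb f i) (≤-trans fi≤gj (≤-reflexive (sym eq)))

minF-< : ∀ {n} (f g : Fin (suc n) → ℕ) → (∀ j → ∃ λ i → f i < g j) → minF f < minF g
minF-< f g below with minF-attained g
... | j , eq with below j
... | i , fi<gj = ≤-<-trans (minF-lb f i) (<-≤-trans fi<gj (≤-reflexive (sym eq)))

module Balls {n : ℕ} (G : Graph n) where

  ball : ℕ → Fin n → Fin n → Bool
  ball = reach G

  ball-zero : ∀ {u v} → ball 0 u v ≡ true → u ≡ v
  ball-zero {u} {v} eq with u ≟ᶠ v
  ... | yes u≡v = u≡v

  ball-refl : ∀ k u → ball k u u ≡ true
  ball-refl zero u with u ≟ᶠ u
  ... | yes _  = refl
  ... | no u≢u = ⊥-elim (u≢u refl)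
  ball-refl (suc k) u rewrite ball-refl k u = refl

  ball-mono : ∀ k {u v} → ball k u v ≡ true → ball (suc k) u v ≡ true
  ball-mono k eq rewrite eq = refl

  ball-step : ∀ k {u w v} → ball k u w ≡ true → adj G w v ≡ true → ball (suc k) u v ≡ true
  ball-step k {u} {w} {v} uw wv with ball k u v
  ... | true  = refl
  ... | false = any-allFin⁺ (λ w → ball k u w ∧ adj G w v) w (cong₂ _∧_ uw wv)

  ball-suc : ∀ k {u v} → ball (suc k) u v ≡ true →
             ball k u v ≡ true ⊎ ∃ λ w → ball k u w ≡ true × adj G w v ≡ true
  ball-suc k {u} {v} eq with ∨-true {ball k u v} eq
  ... | inj₁ uv  = inj₁ uv
  ... | inj₂ viaNeighbour with any-allFin⁻ (λ w → ball k u w ∧ adj G w v) viaNeighbour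
  ... | w , h = inj₂ (w , ∧-true h)

  ball-parent : ∀ k {u v} → ball (suc k) u v ≡ true → ball k u v ≡ false →
                ∃ λ w → ball k u w ≡ true × adj G w v ≡ true
  ball-parent k eq ¬uv with ball-suc k eq
  ... | inj₁ uv     = ⊥-elim (true≢false (trans (sym uv) ¬uv))
  ... | inj₂ parent = parent

  ball-prepend : ∀ k {u w v} → adj G u w ≡ true → ball k w v ≡ true → ball (suc k) u v ≡ true
  ball-prepend zero    uw wv rewrite ball-zero wv = ball-step 0 (ball-refl 0 _) uw
  ball-prepend (suc k) uw wv with ball-suc k wv
  ... | inj₁ wv′            = ball-mono (suc k) (ball-prepend k uw wv′)
  ... | inj₂ (z , wz , zv) = ball-step (suc k) (ball-prepend k uw wz) zv

  ball-sym : ∀ k {u v} → ball k u v ≡ true → ball k v u ≡ true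
  ball-sym zero    uv rewrite ball-zero uv = ball-refl 0 _
  ball-sym (suc k) uv with ball-suc k uv
  ... | inj₁ uv′           = ball-mono k (ball-sym k uv′)
  ... | inj₂ (w , uw , wv) = ball-prepend k (trans (adj-sym G _ w) wv) (ball-sym k uw)

  ball-upClosed : ∀ u v → UpClosed (λ k → ball k u v)
  ball-upClosed u v k = ball-mono k

  dist-≤ : ∀ {u v} i → ball i u v ≡ true → dist G u v ≤ i
  dist-≤ {u} {v} i uv = search-least 0 n (λ k → ball k u v) i z≤n uv

  dist-ball : ∀ {u v} i → dist G u v ≤ i → i < n → ball i u v ≡ true
  dist-ball {u} {v} i d≤i i<n =
    upClosed-≤ (ball-upClosed u v) d≤i (search-found 0 n (λ k → ball k u v) (≤-<-trans d≤i i<n))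

  dist≤n : ∀ u v → dist G u v ≤ n
  dist≤n u v = search-bound 0 n _

  ballSize : ℕ → Fin n → ℕ
  ballSize i v = count (ball i v)

  -- s(v) = Σ_{t < n} #{w | dist(v,w) > t}: each dist(v,w) counts the radii t missing w.
  statusV-balls : ∀ v → statusV G v ≡ ∑ {n} (λ t → count (not ∘ ball (toℕ t) v))
  statusV-balls v = begin
    statusV G v                                             ≡⟨ sumF≡∑ (dist G v) ⟩
    ∑ (λ w → dist G v w)                                    ≡⟨ sum-cong-≗ (λ w → search-count 0 n _ (ball-upClosed v w)) ⟩
    ∑ (λ w → ∑ {n} (λ t → ind (not (ball (toℕ t) v w))))   ≡⟨ ∑-comm {n} {n} (λ w t → ind (not (ball (toℕ t) v w))) ⟩
    ∑ {n} (λ t → count (not ∘ ball (toℕ t) v))              ∎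
    where open ≡-Reasoning

  deg-count : ∀ v → deg G v ≡ count (adj G v)
  deg-count v = sumF≡∑ (ind ∘ adj G v)

  neighbour-distinct : ∀ {u v} → adj G u v ≡ true → ball 0 u v ≡ false
  neighbour-distinct {u} {v} uv with ball 0 u v in near
  ... | false = refl
  ... | true rewrite ball-zero near with trans (sym (adj-irrefl G v)) uv
  ... | ()

  -- A vertex is not its own neighbour, so deg(v) < n.
  deg<n : ∀ v → deg G v < n
  deg<n v = begin-strict
    deg G v                                  ≡⟨ deg-count v ⟩
    count (adj G v)                          ≤⟨ count-mono {P = adj G v} (λ w vw → cong not (neighbour-distinct vw)) ⟩
    count (not ∘ ball 0 v)                   <⟨ m<n+m _ (count-pos (ball 0 v) v (ball-refl 0 v)) ⟩
    count (ball 0 v) + count (not ∘ ball 0 v) ≡⟨ count-compl (ball 0 v) ⟩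
    n                                        ∎
    where open ≤-Reasoning

unique-∷ʳ : ∀ {A : Set} {xs : List A} {y} → Unique xs → All (_≢ y) xs → Unique (xs ∷ʳ y)
unique-∷ʳ []         []           = [] ∷ []
unique-∷ʳ (x∉ ∷ uxs) (x≢y ∷ xs≢y) = ∷ʳ⁺ x∉ x≢y ∷ unique-∷ʳ uxs xs≢y

linked-∷ʳ : ∀ {A : Set} {R : A → A → Set} {x} xs {y z} →
            Linked R (x ∷ (xs ∷ʳ y)) → R y z → Linked R (x ∷ ((xs ∷ʳ y) ∷ʳ z))
linked-∷ʳ []       (r ∷ [-]) yz = r ∷ (yz ∷ [-])
linked-∷ʳ (_ ∷ xs) (r ∷ rs)  yz = r ∷ linked-∷ʳ xs rs yz

length-∷ʳ : ∀ {A : Set} (xs : List A) y → 1 ≤ length (xs ∷ʳ y)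
length-∷ʳ []       y = s≤s z≤n
length-∷ʳ (x ∷ xs) y = s≤s z≤n

module Spheres {n : ℕ} (G : Graph n) (x : Fin n) where
  open Balls G

  sphere : ℕ → Fin n → Bool
  sphere zero    v = ball 0 x v
  sphere (suc j) v = ball (suc j) x v ∧ not (ball j x v)

  sphere⇒ball : ∀ j {v} → sphere j v ≡ true → ball j x v ≡ true
  sphere⇒ball zero    xv = xv
  sphere⇒ball (suc j) xv = proj₁ (∧-true xv)

  sphere⇒outside : ∀ j {v} → sphere (suc j) v ≡ true → ball j x v ≡ false
  sphere⇒outside j {v} xv with ball j x v
  ... | false = refl

  sphere-intro : ∀ j {v} → ball (suc j) x v ≡ true → ball j x v ≡ false → sphere (suc j) v ≡ true
  sphere-intro j inside outside rewrite inside | outside = refl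

  ball⇒¬sphere : ∀ j {v} → ball j x v ≡ true → sphere (suc j) v ≡ false
  ball⇒¬sphere j {v} inside rewrite ball-mono j inside | inside = refl

  outside-mono : ∀ j {v} → ball (suc j) x v ≡ false → ball j x v ≡ false
  outside-mono j {v} outside with ball j x v in inside
  ... | false = refl
  ... | true  with outside
  ... | ()

  inside≢outside : ∀ j {a b} → ball j x a ≡ true → ball j x b ≡ false → a ≢ b
  inside≢outside j inside outside refl with trans (sym inside) outside
  ... | ()

  neighbour-outside : ∀ j {t v} → adj G t v ≡ true → ball (suc j) x v ≡ false → ball j x t ≡ false
  neighbour-outside j {t} tv outside with ball j x t in inside
  ... | false = refl
  ... | true  = trans (sym (ball-step j inside tv)) outside

  sphere-parent : ∀ j {v} → sphere (suc j) v ≡ true → ∃ λ u → sphere j u ≡ true × adj G u v ≡ true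
  sphere-parent j {v} xv with ball-parent j (sphere⇒ball (suc j) xv) (sphere⇒outside j xv)
  ... | u , xu , uv = u , onSphere j xu (sphere⇒outside j xv) , uv
    where
    onSphere : ∀ j → ball j x u ≡ true → ball j x v ≡ false → sphere j u ≡ true
    onSphere zero    xu _   = xu
    onSphere (suc i) xu ¬xv = sphere-intro i xu (neighbour-outside i uv ¬xv)

  ballSize-suc : ∀ j → ballSize (suc j) x ≡ ballSize j x + count (sphere (suc j))
  ballSize-suc j = trans (count-split (ball (suc j) x) (ball j x))
                         (cong (_+ count (sphere (suc j))) (count-cong inner))
    where
    inner : ∀ v → ball (suc j) x v ∧ ball j x v ≡ ball j x v
    inner v with ball j x v in inside
    ... | true  = refl
    ... | false = ∧-zeroʳ _

  children : ℕ → Fin n → ℕ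
  children j u = count (λ v → adj G u v ∧ sphere (suc j) v)

  children≤deg : ∀ j u → children j u ≤ deg G u
  children≤deg j u = ≤-trans (count-mono {Q = adj G u} (λ v uv → proj₁ (∧-true uv))) (≤-reflexive (sym (deg-count u)))

  children-centre : children 0 x ≡ deg G x
  children-centre = trans (count-cong onSphere1) (sym (deg-count x))
    where
    onSphere1 : ∀ v → adj G x v ∧ sphere 1 v ≡ adj G x v
    onSphere1 v with adj G x v in xv
    ... | false = refl
    ... | true  = sphere-intro 0 (ball-step 0 (ball-refl 0 x) xv) (neighbour-distinct xv)

  -- A vertex of sphere j+1 has its parent among its neighbours, which is not a child.
  children<deg : ∀ j u → sphere (suc j) u ≡ true → children (suc j) u < deg G u
  children<deg j u xu with sphere-parent j xu
  ... | p , xp , pu = begin-strict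
    children (suc j) u                                                           <⟨ m<m+n (children (suc j) u) (count-pos _ p notChild) ⟩
    children (suc j) u + count (λ v → adj G u v ∧ not (sphere (suc (suc j)) v)) ≡⟨ sym (count-split (adj G u) (sphere (suc (suc j)))) ⟩
    count (adj G u)                                                              ≡⟨ sym (deg-count u) ⟩
    deg G u                                                                      ∎
    where
    open ≤-Reasoning
    notChild : adj G u p ∧ not (sphere (suc (suc j)) p) ≡ true
    notChild rewrite adj-sym G u p | pu | ball⇒¬sphere (suc j) (ball-mono j (sphere⇒ball j xp)) = refl

  sphere-≤-children : ∀ j → count (sphere (suc j)) ≤ sumOver (sphere j) (children j)
  sphere-≤-children j = count-≤-covering (sphere j) (sphere (suc j)) (adj G) (λ v → sphere-parent j)

-- Spheres around a centre x in an acyclic graph: the breadth-first layers form a rooted tree.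
module AcyclicSpheres {n : ℕ} (G : Graph n) (acyclic : ¬ Cycle G) (x : Fin n) where
  open Balls G
  open Spheres G x

  Outside : ℕ → Fin n → Set
  Outside j v = ball j x v ≡ false

  -- Two vertices of sphere j+1 cannot be joined by a path avoiding the ball of radius j:
  -- following parents from both ends they would meet and close a cycle.
  no-path-outside-ball : ∀ j u zs w →
    Unique (u ∷ (zs ∷ʳ w)) → Linked (Adj G) (u ∷ (zs ∷ʳ w)) → All (Outside j) (u ∷ (zs ∷ʳ w)) →
    sphere (suc j) u ≡ true → sphere (suc j) w ≡ true → ⊥
  no-path-outside-ball j u zs w distinct linked outside xu xw
    with ball-parent j (sphere⇒ball (suc j) xu) (sphere⇒outside j xu)
       | ball-parent j (sphere⇒ball (suc j) xw) (sphere⇒outside j xw)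
  ... | p , xp , pu | q , xq , qw with p ≟ᶠ q
  ... | yes refl = acyclic (p , path , s≤s (length-∷ʳ zs w) ,
                            All.map (λ ¬xv → inside≢outside j xp ¬xv) outside ∷ distinct ,
                            pu ∷ linked-∷ʳ zs linked (trans (adj-sym G w p) qw))
    where path = u ∷ (zs ∷ʳ w)
  no-path-outside-ball zero    u zs w distinct linked outside xu xw | p , xp , pu | q , xq , qw | no p≢q =
    p≢q (trans (sym (ball-zero xp)) (ball-zero xq))
  no-path-outside-ball (suc i) u zs w distinct linked outside xu xw | p , xp , pu | q , xq , qw | no p≢q =
    no-path-outside-ball i p (u ∷ (zs ∷ʳ w)) q
      (∷ʳ⁺ (All.map (inside≢outside (suc i) xp) outside) p≢q
        ∷ unique-∷ʳ distinct (All.map (λ ¬xv v≡q → inside≢outside (suc i) xq ¬xv (sym v≡q)) outside))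
      (pu ∷ linked-∷ʳ zs linked (trans (adj-sym G w q) qw))
      (¬xp ∷ ∷ʳ⁺ (All.map (outside-mono i) outside) ¬xq)
      (sphere-intro i xp ¬xp) (sphere-intro i xq ¬xq)
    where
    ¬xp : Outside i p
    ¬xp = neighbour-outside i pu (sphere⇒outside (suc i) xu)
    ¬xq : Outside i q
    ¬xq = neighbour-outside i qw (sphere⇒outside (suc i) xw)

  parent-unique : ∀ j {u w v} → sphere j u ≡ true → sphere j w ≡ true → sphere (suc j) v ≡ true →
                  adj G u v ≡ true → adj G w v ≡ true → u ≡ w
  parent-unique zero    xu xw xv uv wv = trans (sym (ball-zero xu)) (ball-zero xw)
  parent-unique (suc j) {u} {w} {v} xu xw xv uv wv with u ≟ᶠ w
  ... | yes u≡w = u≡w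
  ... | no  u≢w = ⊥-elim (no-path-outside-ball j u (v ∷ []) w
          ((u≢v ∷ u≢w ∷ []) ∷ ((λ v≡w → w≢v (sym v≡w)) ∷ []) ∷ [] ∷ [])
          (uv ∷ trans (adj-sym G v w) wv ∷ [-])
          (sphere⇒outside j xu ∷ outside-mono j (sphere⇒outside (suc j) xv) ∷ sphere⇒outside j xw ∷ [])
          xu xw)
    where
    u≢v = inside≢outside (suc j) (sphere⇒ball (suc j) xu) (sphere⇒outside (suc j) xv)
    w≢v = inside≢outside (suc j) (sphere⇒ball (suc j) xw) (sphere⇒outside (suc j) xv)

  sphere-independent : ∀ j {u w} → sphere j u ≡ true → sphere j w ≡ true → adj G u w ≡ false
  sphere-independent zero    xu xw rewrite sym (ball-zero xu) | ball-zero xw = adj-irrefl G _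
  sphere-independent (suc j) {u} {w} xu xw with adj G u w in uw
  ... | false = refl
  ... | true  = ⊥-elim (no-path-outside-ball j u [] w ((u≢w ∷ []) ∷ [] ∷ []) (uw ∷ [-])
                          (sphere⇒outside j xu ∷ sphere⇒outside j xw ∷ []) xu xw)
    where
    u≢w : u ≢ w
    u≢w refl with trans (sym (adj-irrefl G u)) uw
    ... | ()

  non-child-is-parent : ∀ j {u v} → sphere (suc j) u ≡ true → adj G u v ≡ true →
                        sphere (suc (suc j)) v ≡ false → sphere j v ≡ true
  non-child-is-parent j {u} {v} xu uv notChild with bool-cases (ball (suc j) x v)
  ... | inj₂ far = ⊥-elim (true≢false (trans (sym child) notChild))
    where child = sphere-intro (suc j) (ball-step (suc j) (sphere⇒ball (suc j) xu) uv) far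
  ... | inj₁ near with bool-cases (ball j x v)
  ... | inj₂ far = ⊥-elim (true≢false (trans (sym uv) (sphere-independent (suc j) xu (sphere-intro j near far))))
  non-child-is-parent zero    xu uv notChild | inj₁ near | inj₁ nearer = nearer
  non-child-is-parent (suc j) {u} {v} xu uv notChild | inj₁ near | inj₁ nearer with bool-cases (ball j x v)
  ... | inj₂ far     = sphere-intro j nearer far
  ... | inj₁ nearest = ⊥-elim (true≢false (trans (sym (ball-step j nearest (trans (adj-sym G v u) uv)))
                                                  (sphere⇒outside (suc j) xu)))

  -- Apart from its children, a vertex of sphere j+1 has only its (unique) parent as neighbour.
  deg≤1+children : ∀ j u → sphere (suc j) u ≡ true → deg G u ≤ suc (children (suc j) u)
  deg≤1+children j u xu = begin
    deg G u                                                                      ≡⟨ deg-count u ⟩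
    count (adj G u)                                                              ≡⟨ count-split (adj G u) (sphere (suc (suc j))) ⟩
    children (suc j) u + count (λ v → adj G u v ∧ not (sphere (suc (suc j)) v)) ≤⟨ +-monoʳ-≤ (children (suc j) u) (count-atMostOne _ oneParent) ⟩
    children (suc j) u + 1                                                       ≡⟨ +-comm (children (suc j) u) 1 ⟩
    suc (children (suc j) u)                                                     ∎
    where
    open ≤-Reasoning
    parentOf : ∀ {v} → adj G u v ∧ not (sphere (suc (suc j)) v) ≡ true → sphere j v ≡ true × adj G v u ≡ true
    parentOf {v} h with ∧-true h
    ... | uv , notChild = non-child-is-parent j xu uv (not-injective notChild)
                        , trans (adj-sym G v u) uv
    oneParent : ∀ v v′ → adj G u v ∧ not (sphere (suc (suc j)) v) ≡ true →
                adj G u v′ ∧ not (sphere (suc (suc j)) v′) ≡ true → v ≡ v′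
    oneParent v v′ h h′ = parent-unique j (proj₁ (parentOf h)) (proj₁ (parentOf h′)) xu
                                          (proj₂ (parentOf h)) (proj₂ (parentOf h′))

  children-≤-sphere : ∀ j → sumOver (sphere j) (children j) ≤ count (sphere (suc j))
  children-≤-sphere j = count-≥-disjoint (sphere j) (sphere (suc j)) (λ u v → adj G u v ∧ sphere (suc j) v)
    (λ u u′ v xu xu′ h h′ → parent-unique j xu xu′ (proj₂ (∧-true {adj G u v} h)) (proj₁ (∧-true h)) (proj₁ (∧-true {adj G u′ v} h′)))
    (λ u v _ h → proj₂ (∧-true {adj G u v} h))

-- Sphere by sphere, T grows at least as fast around x as T′ around y.
module Comparison {n : ℕ} (T : Graph n) (acyclic : ¬ Cycle T) (x : Fin n) {k : ℕ}
                  (balanced : ∀ z → dist T z x + 2 ≤ ecc T x → deg T z ≡ k)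
                  (T′ : Graph n) {ℓ : ℕ} (maxDeg : ∀ v → deg T′ v ≤ ℓ) (ℓ≤k : ℓ ≤ k) (y : Fin n) where
  module B  = Balls T
  module B′ = Balls T′
  module S  = Spheres T x
  module S′ = Spheres T′ y
  module A  = AcyclicSpheres T acyclic x

  e : ℕ
  e = ecc T x

  a b : ℕ → ℕ
  a j = count (S.sphere j)
  b j = count (S′.sphere j)

  deg-inner : ∀ j u → S.sphere j u ≡ true → j + 2 ≤ e → deg T u ≡ k
  deg-inner j u xu j+2≤e = balanced u (≤-trans (+-monoˡ-≤ 2 (B.dist-≤ j (B.ball-sym j (S.sphere⇒ball j xu)))) j+2≤e)

  a-centre : 1 ≤ a 0
  a-centre = count-pos (S.sphere 0) x (B.ball-refl 0 x)

  b-centre : b 0 ≤ 1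
  b-centre = count-atMostOne (S′.sphere 0) (λ u v yu yv → trans (sym (B′.ball-zero yu)) (B′.ball-zero yv))

  a-first : 2 ≤ e → k ≤ a 1
  a-first 2≤e = begin
    k                            ≡⟨ sym (*-identityˡ k) ⟩
    1 * k                        ≤⟨ *-monoˡ-≤ k a-centre ⟩
    a 0 * k                      ≤⟨ sumOver-≥ (S.sphere 0) (S.children 0) k centreChildren ⟩
    sumOver (S.sphere 0) (S.children 0) ≤⟨ A.children-≤-sphere 0 ⟩
    a 1                          ∎
    where
    open ≤-Reasoning
    centreChildren : ∀ u → S.sphere 0 u ≡ true → k ≤ S.children 0 u
    centreChildren u xu with B.ball-zero xu
    ... | refl = ≤-reflexive (trans (sym (deg-inner 0 x xu 2≤e)) (sym S.children-centre))

  a-next : ∀ j → suc (suc j) < e → a (suc j) * pred k ≤ a (suc (suc j))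
  a-next j j+2<e = ≤-trans (sumOver-≥ (S.sphere (suc j)) (S.children (suc j)) (pred k) manyChildren)
                           (A.children-≤-sphere (suc j))
    where
    manyChildren : ∀ u → S.sphere (suc j) u ≡ true → pred k ≤ S.children (suc j) u
    manyChildren u xu rewrite sym (deg-inner (suc j) u xu (≤-trans (≤-reflexive (+-comm (suc j) 2)) j+2<e)) =
      pred-mono-≤ (A.deg≤1+children j u xu)

  b-first : b 1 ≤ ℓ
  b-first = begin
    b 1                                   ≤⟨ S′.sphere-≤-children 0 ⟩
    sumOver (S′.sphere 0) (S′.children 0) ≤⟨ sumOver-≤ (S′.sphere 0) (S′.children 0) ℓ (λ u _ → ≤-trans (S′.children≤deg 0 u) (maxDeg u)) ⟩
    b 0 * ℓ                               ≤⟨ *-monoˡ-≤ ℓ b-centre ⟩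
    1 * ℓ                                 ≡⟨ *-identityˡ ℓ ⟩
    ℓ                                     ∎
    where open ≤-Reasoning

  b-next : ∀ j → b (suc (suc j)) ≤ b (suc j) * pred ℓ
  b-next j = ≤-trans (S′.sphere-≤-children (suc j))
                     (sumOver-≤ (S′.sphere (suc j)) (S′.children (suc j)) (pred ℓ)
                                (λ u yu → <⇒≤pred (<-≤-trans (S′.children<deg j u yu) (maxDeg u))))

  spheres-dominated : ∀ j → j < e → b j ≤ a j
  spheres-dominated zero          _   = ≤-trans b-centre a-centre
  spheres-dominated (suc zero)    1<e = ≤-trans b-first (≤-trans ℓ≤k (a-first 1<e))
  spheres-dominated (suc (suc j)) j<e = begin
    b (suc (suc j))       ≤⟨ b-next j ⟩
    b (suc j) * pred ℓ    ≤⟨ *-mono-≤ (spheres-dominated (suc j) (<-trans (n<1+n _) j<e)) (pred-mono-≤ ℓ≤k) ⟩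
    a (suc j) * pred k    ≤⟨ a-next j j<e ⟩
    a (suc (suc j))       ∎
    where open ≤-Reasoning

  ball-full : ∀ i → e ≤ i → i < n → B.ballSize i x ≡ n
  ball-full i e≤i i<n = count-all (λ w → B.dist-ball i (≤-trans (maxF-ub (dist T x) w) e≤i) i<n)

  balls-dominated : ∀ i → i < n → B′.ballSize i y ≤ B.ballSize i x
  balls-dominated i i<n with i <? e
  ... | no  i≮e = ≤-trans (count≤n _) (≤-reflexive (sym (ball-full i (≮⇒≥ i≮e) i<n)))
  ... | yes i<e = inner i i<e
    where
    inner : ∀ i → i < e → B′.ballSize i y ≤ B.ballSize i x
    inner zero    0<e   = spheres-dominated 0 0<e
    inner (suc i) i+1<e = begin
      B′.ballSize (suc i) y        ≡⟨ S′.ballSize-suc i ⟩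
      B′.ballSize i y + b (suc i)  ≤⟨ +-mono-≤ (inner i (<-trans (n<1+n i) i+1<e)) (spheres-dominated (suc i) i+1<e) ⟩
      B.ballSize i x + a (suc i)   ≡⟨ sym (S.ballSize-suc i) ⟩
      B.ballSize (suc i) x         ∎
      where open ≤-Reasoning

  ball1-strict : ℓ < k → k < n → B′.ballSize 1 y < B.ballSize 1 x
  ball1-strict ℓ<k k<n = begin-strict
    B′.ballSize 1 y   ≡⟨ S′.ballSize-suc 0 ⟩
    b 0 + b 1         ≤⟨ +-mono-≤ b-centre b-first ⟩
    suc ℓ             <⟨ s≤s ℓ<k ⟩
    suc k             ≤⟨ ball1-large ⟩
    B.ballSize 1 x    ∎
    where
    open ≤-Reasoning
    ball1-large : suc k ≤ B.ballSize 1 x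
    ball1-large with 2 ≤? e
    ... | yes 2≤e = ≤-trans (+-mono-≤ a-centre (a-first 2≤e)) (≤-reflexive (sym (S.ballSize-suc 0)))
    ... | no  2≰e = ≤-trans k<n (≤-reflexive (sym (ball-full 1 (≤-pred (≰⇒> 2≰e))
                                                   (≤-<-trans (≤-trans (s≤s z≤n) ℓ<k) k<n))))

  outside-dominated : ∀ i → i < n → count (not ∘ B.ball i x) ≤ count (not ∘ B′.ball i y)
  outside-dominated i i<n = count-compl-≤ (B′.ball i y) (B.ball i x) (balls-dominated i i<n)

  status-≤ : statusV T x ≤ statusV T′ y
  status-≤ = begin
    statusV T x                                         ≡⟨ B.statusV-balls x ⟩
    ∑ {n} (λ t → count (not ∘ B.ball (toℕ t) x))        ≤⟨ ∑-mono-≤ (λ t → outside-dominated (toℕ t) (toℕ<n t)) ⟩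
    ∑ {n} (λ t → count (not ∘ B′.ball (toℕ t) y))       ≡⟨ sym (B′.statusV-balls y) ⟩
    statusV T′ y                                        ∎
    where open ≤-Reasoning

  status-< : ℓ < k → k < n → statusV T x < statusV T′ y
  status-< ℓ<k k<n = begin-strict
    statusV T x                                         ≡⟨ B.statusV-balls x ⟩
    ∑ {n} (λ t → count (not ∘ B.ball (toℕ t) x))        <⟨ ∑-mono-< (λ t → outside-dominated (toℕ t) (toℕ<n t)) one radius1 ⟩
    ∑ {n} (λ t → count (not ∘ B′.ball (toℕ t) y))       ≡⟨ sym (B′.statusV-balls y) ⟩
    statusV T′ y                                        ∎
    where
    open ≤-Reasoning
    1<n : 1 < n
    1<n = ≤-<-trans (≤-trans (s≤s z≤n) ℓ<k) k<n
    one : Fin n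
    one = fromℕ< 1<n
    radius1 : count (not ∘ B.ball (toℕ one) x) < count (not ∘ B′.ball (toℕ one) y)
    radius1 rewrite toℕ-fromℕ< 1<n = count-compl-< (B′.ball 1 y) (B.ball 1 x) (ball1-strict ℓ<k k<n)

  -- ecc′(y) is a radius at which the ball around y, hence also the one around x, is everything.
  ecc-≤ : ecc T x ≤ ecc T′ y
  ecc-≤ with ecc T′ y <? n
  ... | no  ecc′≮n = ≤-trans (maxF-lub (dist T x) n (B.dist≤n x)) (≮⇒≥ ecc′≮n)
  ... | yes ecc′<n = maxF-lub (dist T x) (ecc T′ y) (λ w → B.dist-≤ (ecc T′ y) (count-full (B.ball (ecc T′ y) x) everything w))
    where
    everything : n ≤ B.ballSize (ecc T′ y) x
    everything = ≤-trans (≤-reflexive (sym (count-all (λ w → B′.dist-ball (ecc T′ y) (maxF-ub (dist T′ y) w) ecc′<n))))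
                         (balls-dominated (ecc T′ y) ecc′<n)

lemma2 : (n k ℓ : ℕ) → 2 ≤ ℓ → ℓ ≤ k → k ≤ n →
         (T : Graph n) → IsBalancedTree T k →
         (T′ : Graph n) → IsBalancedTree T′ ℓ →
         (status T ≤ status T′) × ((status T ≡ status T′) ⇔ (k ≡ ℓ)) × (rad T ≤ rad T′)
lemma2 zero    k ℓ 2≤ℓ ℓ≤k k≤0 with ≤-trans 2≤ℓ (≤-trans ℓ≤k k≤0)
... | ()
lemma2 (suc m) k ℓ 2≤ℓ ℓ≤k k≤n
       T  ((_ , acyclic)  , (maxDeg  , z , deg-z) , x  , balanced)
       T′ ((_ , acyclic′) , (maxDeg′ , _)         , x′ , balanced′) =
  status≤ , mk⇔ equal⇒k≡ℓ k≡ℓ⇒equal , rad≤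
  where
  module C = Comparison T acyclic x balanced T′ maxDeg′ ℓ≤k

  status≤ : status T ≤ status T′
  status≤ = minF-≤ (statusV T) (statusV T′) (λ y → x , C.status-≤ y)

  rad≤ : rad T ≤ rad T′
  rad≤ = minF-≤ (ecc T) (ecc T′) (λ y → x , C.ecc-≤ y)

  -- A vertex of degree k exists, so k < n; if ℓ < k the status strictly drops.
  equal⇒k≡ℓ : status T ≡ status T′ → k ≡ ℓ
  equal⇒k≡ℓ eq with m≤n⇒m<n∨m≡n ℓ≤k
  ... | inj₂ ℓ≡k = sym ℓ≡k
  ... | inj₁ ℓ<k = ⊥-elim (<-irrefl eq (minF-< (statusV T) (statusV T′) (λ y → x , C.status-< y ℓ<k k<n)))
    where
    k<n : k < suc m
    k<n = subst (_< suc m) deg-z (Balls.deg<n T z)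

  -- For k = ℓ the comparison applies in both directions.
  k≡ℓ⇒equal : k ≡ ℓ → status T ≡ status T′
  k≡ℓ⇒equal refl = ≤-antisym status≤ (minF-≤ (statusV T′) (statusV T) (λ y → x′ , C′.status-≤ y))
    where module C′ = Comparison T′ acyclic′ x′ balanced′ T maxDeg ≤-refl
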